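{- For every positive integer $n$, there exists a tree-decomposition $\mathcal{T}$ of $G_n$ such that every bag of $\mathcal{T}$ induces a star forest in $G_n$, and every member of $\mathcal{S}_n$ is contained in some bag of $\mathcal{T}$.
   Context: Define recursively pairs $(G_n,\mathcal{S}_n)$, where $G_n$ is a graph and $\mathcal{S}_n$ a collection of stable sets of $G_n$: $G_1=K_1$ and $\mathcal{S}_1=\{V(G_1)\}$. For $n\ge 2$: for each $S\in\mathcal{S}_{n-1}$ create a (vertex-disjoint) copy $G_S$ of $G_{n-1}$ and let $\mathcal{S}_S$ be the collection of copies in $G_S$ of the members of $\mathcal{S}_{n-1}$; let $G_n$ be obtained from the disjoint union $G_{n-1}\cup\bigcup_{S\in\mathcal{S}_{n-1}}G_S$ by, for each $S\in\mathcal{S}_{n-1}$ and each $Q\in\mathcal{S}_S$, adding a new vertex $v_{S,Q}$ adjacent exactly to all vertices of $Q$; and let $\mathcal{S}_n=\{S\cup Q,\ S\cup\{v_{S,Q}\} : S\in\mathcal{S}_{n-1}, Q\in\mathcal{S}_S\}$. A tree-decomposition of a graph $G$ is a pair $(T,\{X_t\}_{t\in V(T)})$ where $T$ is a tree and $X_t\subseteq V(G)$ (bags), such that every edge of $G$ has both ends in some bag and for every vertex $v$ the nodes $t$ with $v\in X_t$ induce a non-empty connected subtree of $T$. A star forest is a graph each of whose components is a star ($K_1$ counts as a star). -}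

module Defs where

open import Data.Nat using (ℕ; zero; suc; _≤_)
open import Data.Fin using (Fin)
open import Data.Bool using (Bool; true; false)
open import Data.Unit using (⊤; tt)
open import Data.Empty using (⊥)
open import Data.Product using (_×_; ∃; ∃-syntax; _,_)
open import Data.Sum using (_⊎_)
open import Data.List using (List; []; _∷_; _∷ʳ_; length)
open import Data.List.Relation.Unary.Unique.Propositional using (Unique)
open import Data.List.Relation.Unary.Linked using (Linked)
open import Relation.Binary.PropositionalEquality using (_≡_)
open import Relation.Nullary using (¬_)

data Conn {A : Set} (R : A → A → Set) (P : A → Set) : A → A → Set where
  here : ∀ {x} → P x → Conn R P x x
  step : ∀ {x y z} → P x → R x y → Conn R P y z → Conn R P x z

record Cycle {A : Set} (R : A → A → Set) : Set where
  field
    first    : A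
    rest     : List A
    long     : 2 ≤ length rest
    distinct : Unique (first ∷ rest)
    closed   : Linked R ((first ∷ rest) ∷ʳ first)

record IsTree {m : ℕ} (R : Fin m → Fin m → Set) : Set where
  field
    symmetric : ∀ a b → R a b → R b a
    loopless  : ∀ a → ¬ R a a
    connected : ∀ a b → Conn R (λ _ → ⊤) a b
    acyclic   : ¬ Cycle R

record TreeDecomposition (V : Set) (E : V → V → Set) : Set₁ where
  field
    m          : ℕ
    T          : Fin m → Fin m → Set
    isTree     : IsTree T
    bag        : Fin m → V → Set
    edge-cover : ∀ u v → E u v → ∃[ t ] (bag t u × bag t v)
    nonempty   : ∀ v → ∃[ t ] bag t v
    subtree    : ∀ v t t' → bag t v → bag t' v → Conn T (λ s → bag s v) t t'

-- The subgraph of (V , E) induced by P is a star forest: every component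
-- (the set of vertices joined to x by a walk inside P) contains a centre c
-- such that every edge of the component is incident with c.
StarForest : {V : Set} → (E : V → V → Set) → (P : V → Set) → Set
StarForest {V} E P =
  ∀ x → P x → ∃[ c ] (Conn E P x c ×
    (∀ y z → Conn E P x y → Conn E P x z → E y z → (y ≡ c) ⊎ (z ≡ c)))

-- GV n = vertices of G_n, Adj n = edges,
-- Ix n indexes the collection S_n, Mem n S v  means  v ∈ S.
-- Index n = 0 is a dummy (empty graph); the construction starts at n = 1.

-- Vertices of G_{n+1}: the old copy of G_n, the copies G_S (S ∈ S_n),
-- and the new vertices v_{S,Q} (S ∈ S_n, Q ∈ S_S, Q identified with the
-- member of S_n it is a copy of).
data NextV (A I : Set) : Set where
  base : A → NextV A I
  copy : I → A → NextV A I
  new  : I → I → NextV A I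

Ix : ℕ → Set
Ix zero = ⊥
Ix (suc zero) = ⊤
-- (S , Q , true) ↦ S ∪ Q ,  (S , Q , false) ↦ S ∪ {v_{S,Q}}
Ix (suc (suc k)) = Ix (suc k) × Ix (suc k) × Bool

GV : ℕ → Set
GV zero = ⊥
GV (suc zero) = ⊤
GV (suc (suc k)) = NextV (GV (suc k)) (Ix (suc k))

Mem : (n : ℕ) → Ix n → GV n → Set
Mem zero () _
Mem (suc zero) tt tt = ⊤
Mem (suc (suc k)) (S , Q , true)  (base u)    = Mem (suc k) S u
Mem (suc (suc k)) (S , Q , true)  (copy S' u) = (S' ≡ S) × Mem (suc k) Q u
Mem (suc (suc k)) (S , Q , true)  (new _ _)   = ⊥
Mem (suc (suc k)) (S , Q , false) (base u)    = Mem (suc k) S u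
Mem (suc (suc k)) (S , Q , false) (copy _ _)  = ⊥
Mem (suc (suc k)) (S , Q , false) (new S' Q') = (S' ≡ S) × (Q' ≡ Q)

Adj : (n : ℕ) → GV n → GV n → Set
Adj zero () _
Adj (suc zero) tt tt = ⊥
Adj (suc (suc k)) (base u)   (base v)    = Adj (suc k) u v
Adj (suc (suc k)) (copy S u) (copy S' v) = (S ≡ S') × Adj (suc k) u v
Adj (suc (suc k)) (copy S u) (new S' Q)  = (S ≡ S') × Mem (suc k) Q u
Adj (suc (suc k)) (new S Q)  (copy S' u) = (S ≡ S') × Mem (suc k) Q u
Adj (suc (suc k)) _ _ = ⊥

{-# OPTIONS --safe #-}
-- Suppose G_n has a tree-decomposition whose bags induce star forests and in which
-- each S ∈ S_n lies in the bag of a node t_S. For G_{n+1} keep it on the old copy of G_n; for each S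
-- add a copy of it for G_S with S added to every bag, its root joined to t_S; and for each Q attach to
-- the copy of t_Q a leaf with bag S ∪ Q ∪ {v_{S,Q}}, which contains both new members S ∪ Q and
-- S ∪ {v_{S,Q}}. As S is stable and has no neighbours in G_S ∪ {v_{S,Q}}, and Q ∪ {v_{S,Q}} is a
-- star, the new bags are still star forests. The trees are built from parent pointers that decrease a
-- rank, which makes acyclicity a statement about non-backtracking walks.
module Submission where

open import Defs
open import Data.Nat using (ℕ; zero; suc; _+_; _<_; _≤_; s≤s)
open import Data.Nat.Properties using (<-trans; <-irrefl; +-monoʳ-<; m≤m+n; n<1+n)
open import Data.Product using (Σ; Σ-syntax; ∃-syntax; _×_; _,_; proj₁; proj₂)
open import Data.Sum using (_⊎_; inj₁; inj₂; swap)
import Data.Sum as Sum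
open import Data.Unit using (⊤; tt)
open import Data.Empty using (⊥; ⊥-elim)
open import Data.Bool using (Bool; true; false)
open import Data.Fin using (Fin)
open import Data.Fin.Properties using (1↔⊤; 2↔Bool; +↔⊎; *↔×)
open import Data.List using ([]; _∷_; _∷ʳ_)
open import Data.List.Membership.Propositional using (_∈_)
open import Data.List.Relation.Unary.All using (All; _∷_; lookup)
open import Data.List.Relation.Unary.AllPairs using (AllPairs; _∷_)
open import Data.List.Relation.Unary.Any using (here; there)
open import Data.List.Relation.Unary.Linked using (Linked; [-]; _∷_)
open import Data.Sum.Function.Propositional using (_⊎-↔_)
open import Data.Product.Function.NonDependent.Propositional using (_×-↔_)
open import Function using (_↔_; Inverse; _on_; _∘_)
open import Function.Properties.Inverse using (↔-sym; ↔-trans)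
open import Relation.Binary.Construct.Closure.Symmetric using (SymClosure; fwd; bwd; gmap)
import Relation.Binary.Construct.Closure.Symmetric as SymClosure
open import Relation.Binary.PropositionalEquality using (_≡_; _≢_; refl; sym; trans; cong; subst; subst₂; ≢-sym)
open import Relation.Nullary using (¬_)
open import Relation.Unary using (U; _⊆_; _∪_; ｛_｝)

module _ {A : Set} {R : A → A → Set} {P : A → Set} where

  conn-start : ∀ {x y} → Conn R P x y → P x
  conn-start (here p)     = p
  conn-start (step p _ _) = p

  conn-end : ∀ {x y} → Conn R P x y → P y
  conn-end (here p)     = p
  conn-end (step _ _ c) = conn-end c

  conn-++ : ∀ {x y z} → Conn R P x y → Conn R P y z → Conn R P x z
  conn-++ (here _)     d = d
  conn-++ (step p e c) d = step p e (conn-++ c d)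

  conn-reverse : (∀ {x y} → R x y → R y x) → ∀ {x y} → Conn R P x y → Conn R P y x
  conn-reverse sym-R (here p)     = here p
  conn-reverse sym-R (step p e c) = conn-++ (conn-reverse sym-R c) (step (conn-start c) (sym-R e) (here p))

conn-map : ∀ {A B : Set} {R : A → A → Set} {P : A → Set} {R′ : B → B → Set} {P′ : B → Set}
  (h : A → B) → (∀ {x y} → R x y → R′ (h x) (h y)) → (∀ {x} → P x → P′ (h x)) →
  ∀ {x y} → Conn R P x y → Conn R′ P′ (h x) (h y)
conn-map h h-edge h-mem (here p)     = here (h-mem p)
conn-map h h-edge h-mem (step p e c) = step (h-mem p) (h-edge e) (conn-map h h-edge h-mem c)

conn-weaken : ∀ {A : Set} {R : A → A → Set} {P Q : A → Set} → P ⊆ Q → ∀ {x y} → Conn R P x y → Conn R Q x y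
conn-weaken P⊆Q = conn-map (λ x → x) (λ e → e) P⊆Q

-- Star forests

module _ {V : Set} {E : V → V → Set} where

  Separated : (V → Set) → (V → Set) → Set
  Separated P Q = ∀ {u w} → P u → Q w → ¬ E u w

  Stable : (V → Set) → Set
  Stable P = Separated P P

  StarComponent : (V → Set) → V → Set
  StarComponent P x = ∃[ c ] (Conn E P x c ×
    (∀ y z → Conn E P x y → Conn E P x z → E y z → (y ≡ c) ⊎ (z ≡ c)))

  StarComponent-widen : ∀ {P Q x} → P ⊆ Q → (∀ {y} → Conn E Q x y → Conn E P x y) →
    StarComponent P x → StarComponent Q x
  StarComponent-widen P⊆Q narrow (c , x⇝c , centred) =
    c , conn-weaken P⊆Q x⇝c , λ y z x⇝y x⇝z → centred y z (narrow x⇝y) (narrow x⇝z)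

  conn-stays : ∀ {P Q W} → W ⊆ P ∪ Q → Separated P Q → ∀ {x y} → Conn E W x y → P x → Conn E P x y
  conn-stays split sep (here _)     px = here px
  conn-stays split sep (step _ e c) px with split (conn-start c)
  ... | inj₁ py = step px e (conn-stays split sep c py)
  ... | inj₂ qy = ⊥-elim (sep px qy e)

  Stable⇒StarForest : ∀ {P} → Stable P → StarForest E P
  Stable⇒StarForest stable x px =
    x , here px , λ y z x⇝y x⇝z e → ⊥-elim (stable (conn-end x⇝y) (conn-end x⇝z) e)

  star-StarForest : ∀ {Q c} → Stable Q → (∀ {x} → Q x → E x c) → StarForest E (Q ∪ ｛ c ｝)
  star-StarForest {Q} {c} stable spoke x px =
    c , to-centre px , λ y z x⇝y x⇝z → centred (conn-end x⇝y) (conn-end x⇝z)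
    where
    to-centre : ∀ {x} → (Q ∪ ｛ c ｝) x → Conn E (Q ∪ ｛ c ｝) x c
    to-centre (inj₁ q)    = step (inj₁ q) (spoke q) (here (inj₂ refl))
    to-centre (inj₂ refl) = here (inj₂ refl)
    centred : ∀ {y z} → (Q ∪ ｛ c ｝) y → (Q ∪ ｛ c ｝) z → E y z → (y ≡ c) ⊎ (z ≡ c)
    centred (inj₁ qy)   (inj₁ qz)   e = ⊥-elim (stable qy qz e)
    centred (inj₂ refl) _           _ = inj₁ refl
    centred (inj₁ _)    (inj₂ refl) _ = inj₂ refl

  StarForest-∪ : ∀ {P Q} → StarForest E P → StarForest E Q → Separated P Q → Separated Q P →
    StarForest E (P ∪ Q)
  StarForest-∪ sfP sfQ P∤Q Q∤P x (inj₁ px) =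
    StarComponent-widen inj₁ (λ c → conn-stays (λ w → w) P∤Q c px) (sfP x px)
  StarForest-∪ sfP sfQ P∤Q Q∤P x (inj₂ qx) =
    StarComponent-widen inj₂ (λ c → conn-stays swap Q∤P c qx) (sfQ x qx)

module _ {A B : Set} {EA : A → A → Set} {EB : B → B → Set} {PA : A → Set} {PB : B → Set}
  (h : A → B)
  (h-edge : ∀ {a a′} → EA a a′ → EB (h a) (h a′)) (h-edge⁻ : ∀ {a a′} → EB (h a) (h a′) → EA a a′)
  (h-mem : ∀ {a} → PA a → PB (h a)) (h-onto : ∀ {b} → PB b → ∃[ a ] (PA a × h a ≡ b)) where

  private
    lift-walk : ∀ {a y} → PA a → Conn EB PB (h a) y → ∃[ a′ ] (h a′ ≡ y × Conn EA PA a a′)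
    lift-walk pa (here _) = _ , refl , here pa
    lift-walk pa (step _ e c) with h-onto (conn-start c)
    ... | a₁ , pa₁ , refl with lift-walk pa₁ c
    ...   | a′ , refl , c′ = a′ , refl , step pa (h-edge⁻ e) c′

  StarForest-image : StarForest EA PA → StarForest EB PB
  StarForest-image sf x px with h-onto px
  ... | a , pa , refl with sf a pa
  ...   | c , a⇝c , centred = h c , conn-map h h-edge h-mem a⇝c , centred′
    where
    centred′ : ∀ y z → Conn EB PB (h a) y → Conn EB PB (h a) z → EB y z → (y ≡ h c) ⊎ (z ≡ h c)
    centred′ y z a⇝y a⇝z e with lift-walk pa a⇝y | lift-walk pa a⇝z
    ... | y′ , refl , c₁ | z′ , refl , c₂ = Sum.map (cong h) (cong h) (centred y′ z′ c₁ c₂ (h-edge⁻ e))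

-- Forests given by parent pointers

record IsForest {A : Set} (Parent : A → A → Set) : Set where
  field
    parent-unique   : ∀ {a b c} → Parent a b → Parent a c → b ≡ c
    rank            : A → ℕ
    rank-decreasing : ∀ {a b} → Parent a b → rank b < rank a

module _ {A : Set} {Parent : A → A → Set} (forest : IsForest Parent) where
  open IsForest forest

  private
    Edge : A → A → Set
    Edge = SymClosure Parent

  -- A non-backtracking walk whose first edge is p x and whose last edge is q z.
  data Trail : A → A → A → A → Set where
    edge : ∀ {p x} → Edge p x → Trail p x p x
    step : ∀ {p x y q z} → Edge p x → y ≢ p → Trail x y q z → Trail p x q z

  first-edge : ∀ {p x q z} → Trail p x q z → Edge p x
  first-edge (edge e)     = e
  first-edge (step e _ _) = e

  last-edge : ∀ {p x q z} → Trail p x q z → Edge q z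
  last-edge (edge e)     = e
  last-edge (step _ _ t) = last-edge t

  -- Once a trail steps from a parent to a child it can only keep descending.
  descend : ∀ {p x q z} → Trail p x q z → Parent x p → rank p < rank z
  descend (edge _)       xp = rank-decreasing xp
  descend (step _ y≢p t) xp with first-edge t
  ... | fwd xy = ⊥-elim (y≢p (parent-unique xy xp))
  ... | bwd yx = <-trans (rank-decreasing xp) (descend t yx)

  ascend : ∀ {p x q z} → Trail p x q z → Parent q z → Parent p x × rank z < rank p
  ascend (edge _)         qz = qz , rank-decreasing qz
  ascend (step px y≢p t) qz with ascend t qz | px
  ... | _  , z<x | fwd px′ = px′ , <-trans z<x (rank-decreasing px′)
  ... | xy , _   | bwd xp  = ⊥-elim (y≢p (parent-unique xy xp))

  no-closed-trail : ∀ {p x q} → Trail p x q p → x ≢ q → ⊥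
  no-closed-trail t x≢q with first-edge t | last-edge t
  ... | bwd xp | _      = <-irrefl refl (descend t xp)
  ... | fwd _  | fwd qp = <-irrefl refl (proj₂ (ascend t qp))
  ... | fwd px | bwd pq = x≢q (parent-unique px pq)

  private
    trail : ∀ {p x z} ys → Linked Edge (p ∷ x ∷ ys ∷ʳ z) → AllPairs _≢_ (p ∷ x ∷ ys) →
      All (z ≢_) (p ∷ x ∷ ys) → ∃[ q ] (q ∈ x ∷ ys × Trail p x q z)
    trail []       (px ∷ xz ∷ [-]) _ (z≢p ∷ _) = _ , here refl , step px z≢p (edge xz)
    trail (y ∷ ys) (px ∷ linked) ((_ ∷ p≢y ∷ _) ∷ distinct) (_ ∷ z∉) with trail ys linked distinct z∉
    ... | q , q∈ , t = q , there q∈ , step px (≢-sym p≢y) t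

  acyclic : ¬ Cycle Edge
  acyclic record { rest = [] ; long = () }
  acyclic record { rest = _ ∷ [] ; long = s≤s () }
  acyclic record { rest = r₁ ∷ r₂ ∷ rs ; distinct = x₀∉ ∷ (r₁∉ ∷ distinct) ; closed = x₀r₁ ∷ closed }
    with trail rs closed (r₁∉ ∷ distinct) x₀∉
  ... | q , q∈ , t = no-closed-trail (step x₀r₁ (≢-sym (lookup x₀∉ (there (here refl)))) t) (lookup r₁∉ q∈)

IsForest-pullback : ∀ {A B : Set} {Parent : A → A → Set} (f : B → A) →
  (∀ {x y} → f x ≡ f y → x ≡ y) → IsForest Parent → IsForest (Parent on f)
IsForest-pullback f f-injective forest = record
  { parent-unique   = λ p q → f-injective (parent-unique p q)
  ; rank            = rank ∘ f
  ; rank-decreasing = rank-decreasing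
  }
  where open IsForest forest

IsForest⇒IsTree : ∀ {m} {Parent : Fin m → Fin m → Set} → IsForest Parent →
  (∀ a b → Conn (SymClosure Parent) U a b) → IsTree (SymClosure Parent)
IsForest⇒IsTree {Parent = Parent} forest connected = record
  { symmetric = λ _ _ → SymClosure.symmetric Parent
  ; loopless  = loopless
  ; connected = connected
  ; acyclic   = acyclic forest
  }
  where
  open IsForest forest
  loopless : ∀ a → ¬ SymClosure Parent a a
  loopless a (fwd p) = <-irrefl refl (rank-decreasing p)
  loopless a (bwd p) = <-irrefl refl (rank-decreasing p)

Finite : Set → Set
Finite A = Σ[ m ∈ ℕ ] (A ↔ Fin m)

finite-⊤ : Finite ⊤
finite-⊤ = 1 , ↔-sym 1↔⊤

finite-Bool : Finite Bool
finite-Bool = 2 , ↔-sym 2↔Bool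

finite-⊎ : ∀ {A B} → Finite A → Finite B → Finite (A ⊎ B)
finite-⊎ (m , A↔m) (n , B↔n) = m + n , ↔-trans (A↔m ⊎-↔ B↔n) (↔-sym +↔⊎)

finite-× : ∀ {A B} → Finite A → Finite B → Finite (A × B)
finite-× (m , A↔m) (n , B↔n) = _ , ↔-trans (A↔m ×-↔ B↔n) (↔-sym *↔×)

record RootedTree (N : Set) : Set₁ where
  field
    Parent          : N → N → Set
    forest          : IsForest Parent
    root            : N
    root-parentless : ∀ {b} → ¬ Parent root b
    to-root         : ∀ a → Conn (SymClosure Parent) U a root
  open IsForest forest public

record RootedDecomposition (V : Set) (E : V → V → Set) : Set₁ where
  field
    Node   : Set
    finite : Finite Node
    tree   : RootedTree Node
  open RootedTree tree public
  field
    bag        : Node → V → Set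
    edge-cover : ∀ u v → E u v → ∃[ t ] (bag t u × bag t v)
    home       : V → Node
    home-bag   : ∀ v → bag (home v) v
    to-home    : ∀ {v} t → bag t v → Conn (SymClosure Parent) (λ s → bag s v) t (home v)

module _ {V : Set} {E : V → V → Set} (D : RootedDecomposition V E) where
  open RootedDecomposition D
  open Inverse (proj₂ finite)

  private
    m : ℕ
    m = proj₁ finite

    T : Fin m → Fin m → Set
    T = SymClosure (Parent on from)

    from-injective : ∀ {i j} → from i ≡ from j → i ≡ j
    from-injective {i} {j} eq = trans (sym (strictlyInverseˡ i)) (trans (cong to eq) (strictlyInverseˡ j))

    reindex : ∀ {P : Node → Set} {i j} → Conn (SymClosure Parent) P (from i) (from j) → Conn T (P ∘ from) i j
    reindex {P} {i} {j} c = subst₂ (Conn T (P ∘ from)) (strictlyInverseˡ i) (strictlyInverseˡ j)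
      (conn-map to (gmap to (λ {x} {y} → subst₂ Parent (sym (strictlyInverseʳ x)) (sym (strictlyInverseʳ y))))
                   (λ {x} → subst P (sym (strictlyInverseʳ x))) c)

    conn-via : ∀ {P : Node → Set} {a b c} → Conn (SymClosure Parent) P a c → Conn (SymClosure Parent) P b c →
      Conn (SymClosure Parent) P a b
    conn-via a⇝c b⇝c = conn-++ a⇝c (conn-reverse (SymClosure.symmetric Parent) b⇝c)

  bag-to : ∀ {t v} → bag t v → bag (from (to t)) v
  bag-to {t} {v} = subst (λ s → bag s v) (sym (strictlyInverseʳ t))

  toTreeDecomposition : TreeDecomposition V E
  toTreeDecomposition = record
    { m          = m
    ; T          = T
    ; isTree     = IsForest⇒IsTree (IsForest-pullback from from-injective forest)
                     λ i j → reindex (conn-via (to-root (from i)) (to-root (from j)))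
    ; bag        = bag ∘ from
    ; edge-cover = λ u v e → let t , bu , bv = edge-cover u v e in to t , bag-to bu , bag-to bv
    ; nonempty   = λ v → to (home v) , bag-to (home-bag v)
    ; subtree    = λ v i j bi bj → reindex (conn-via (to-home (from i) bi) (to-home (from j) bj))
    }

-- Grafting copies of a rooted tree onto itself

GraftNode : Set → Set → Set
GraftNode N I = N ⊎ (I × N) ⊎ (I × I)

pattern old t      = inj₁ t
pattern copied S t = inj₂ (inj₁ (S , t))
pattern leaf S Q   = inj₂ (inj₂ (S , Q))

module Graft {N I : Set} (T : RootedTree N) (holder : I → N) where
  open RootedTree T

  data Parent⁺ : GraftNode N I → GraftNode N I → Set where
    old-parent    : ∀ {a b} → Parent a b → Parent⁺ (old a) (old b)
    copied-parent : ∀ {S a b} → Parent a b → Parent⁺ (copied S a) (copied S b)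
    root-parent   : ∀ {S} → Parent⁺ (copied S root) (old (holder S))
    leaf-parent   : ∀ {S Q} → Parent⁺ (leaf S Q) (copied S (holder Q))

  Edge⁺ : GraftNode N I → GraftNode N I → Set
  Edge⁺ = SymClosure Parent⁺

  old-walk : ∀ {P : N → Set} {P⁺ : GraftNode N I → Set} → (∀ {a} → P a → P⁺ (old a)) →
    ∀ {a b} → Conn (SymClosure Parent) P a b → Conn Edge⁺ P⁺ (old a) (old b)
  old-walk = conn-map old (gmap old old-parent)

  copied-walk : ∀ S {P : N → Set} {P⁺ : GraftNode N I → Set} → (∀ {a} → P a → P⁺ (copied S a)) →
    ∀ {a b} → Conn (SymClosure Parent) P a b → Conn Edge⁺ P⁺ (copied S a) (copied S b)
  copied-walk S = conn-map (copied S) (gmap (copied S) copied-parent)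

  copied-to-holder : ∀ S {P : GraftNode N I → Set} → (∀ a → P (copied S a)) → P (old (holder S)) →
    ∀ a → Conn Edge⁺ P (copied S a) (old (holder S))
  copied-to-holder S on-copy on-holder a =
    conn-++ (copied-walk S (λ {b} _ → on-copy b) (to-root a))
            (step (on-copy root) (fwd root-parent) (here on-holder))

  private
    unique⁺ : ∀ {a b c} → Parent⁺ a b → Parent⁺ a c → b ≡ c
    unique⁺ (old-parent p)    (old-parent q)    = cong old (parent-unique p q)
    unique⁺ (copied-parent p) (copied-parent q) = cong (copied _) (parent-unique p q)
    unique⁺ (copied-parent p) root-parent       = ⊥-elim (root-parentless p)
    unique⁺ root-parent       (copied-parent q) = ⊥-elim (root-parentless q)
    unique⁺ root-parent       root-parent       = refl
    unique⁺ leaf-parent       leaf-parent       = refl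

    rank⁺ : GraftNode N I → ℕ
    rank⁺ (old a)      = rank a
    rank⁺ (copied S a) = suc (rank (holder S) + rank a)
    rank⁺ (leaf S Q)   = suc (suc (rank (holder S) + rank (holder Q)))

    decreasing⁺ : ∀ {a b} → Parent⁺ a b → rank⁺ b < rank⁺ a
    decreasing⁺ (old-parent p)        = rank-decreasing p
    decreasing⁺ (copied-parent {S} p) = s≤s (+-monoʳ-< (rank (holder S)) (rank-decreasing p))
    decreasing⁺ (root-parent {S})     = s≤s (m≤m+n (rank (holder S)) (rank root))
    decreasing⁺ (leaf-parent {S} {Q}) = n<1+n (suc (rank (holder S) + rank (holder Q)))

    old-to-root : ∀ a → Conn Edge⁺ U (old a) (old root)
    old-to-root a = old-walk _ (to-root a)

    copied-to-root : ∀ S a → Conn Edge⁺ U (copied S a) (old root)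
    copied-to-root S a = conn-++ (copied-to-holder S _ _ a) (old-to-root (holder S))

    to-root⁺ : ∀ a → Conn Edge⁺ U a (old root)
    to-root⁺ (old a)      = old-to-root a
    to-root⁺ (copied S a) = copied-to-root S a
    to-root⁺ (leaf S Q)   = step _ (fwd leaf-parent) (copied-to-root S (holder Q))

  grafted : RootedTree (GraftNode N I)
  grafted = record
    { Parent          = Parent⁺
    ; forest          = record { parent-unique = unique⁺ ; rank = rank⁺ ; rank-decreasing = decreasing⁺ }
    ; root            = old root
    ; root-parentless = λ { (old-parent p) → root-parentless p }
    ; to-root         = to-root⁺
    }

Mem-stable : ∀ n (S : Ix n) → Stable {E = Adj n} (Mem n S)
Mem-stable (suc zero)    _                                      _       _        ()
Mem-stable (suc (suc k)) (S , Q , true)  {base _}   {base _}   m       m′       e       = Mem-stable (suc k) S m m′ e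
Mem-stable (suc (suc k)) (S , Q , true)  {copy _ _} {copy _ _} (_ , m) (_ , m′) (_ , e) = Mem-stable (suc k) Q m m′ e
Mem-stable (suc (suc k)) (S , Q , true)  {new _ _}  ()
Mem-stable (suc (suc k)) (S , Q , true)  {_}        {new _ _}  _       ()
Mem-stable (suc (suc k)) (S , Q , true)  {base _}   {copy _ _} _       _        ()
Mem-stable (suc (suc k)) (S , Q , true)  {copy _ _} {base _}   _       _        ()
Mem-stable (suc (suc k)) (S , Q , false) {base _}   {base _}   m       m′       e       = Mem-stable (suc k) S m m′ e
Mem-stable (suc (suc k)) (S , Q , false) {copy _ _} ()
Mem-stable (suc (suc k)) (S , Q , false) {_}        {copy _ _} _       ()
Mem-stable (suc (suc k)) (S , Q , false) {base _}   {new _ _}  _       _        ()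
Mem-stable (suc (suc k)) (S , Q , false) {new _ _}  {base _}   _       _        ()
Mem-stable (suc (suc k)) (S , Q , false) {new _ _}  {new _ _}  _       _        ()

data Base {A I : Set} (P : A → Set) : NextV A I → Set where
  base : ∀ {u} → P u → Base P (base u)

data Copy {A I : Set} (S : I) (P : A → Set) : NextV A I → Set where
  copy : ∀ {u} → P u → Copy S P (copy S u)

module _ {k : ℕ} where
  private
    V⁺ : Set
    V⁺ = GV (suc (suc k))

    E⁺ : V⁺ → V⁺ → Set
    E⁺ = Adj (suc (suc k))

  Base-StarForest : ∀ {P} → StarForest (Adj (suc k)) P → StarForest E⁺ (Base P)
  Base-StarForest = StarForest-image base (λ e → e) (λ e → e) base λ { (base p) → _ , p , refl }

  Copy-StarForest : ∀ {S P} → StarForest (Adj (suc k)) P → StarForest E⁺ (Copy S P)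
  Copy-StarForest {S} = StarForest-image (copy S) (refl ,_) proj₂ copy λ { (copy p) → _ , p , refl }

  Copy-stable : ∀ {S P} → Stable {E = Adj (suc k)} P → Stable {E = E⁺} (Copy S P)
  Copy-stable stable (copy p) (copy p′) (_ , e) = stable p p′ e

  Base-∪-StarForest : ∀ {P Q} → StarForest (Adj (suc k)) P → StarForest E⁺ Q → (∀ {u} → ¬ Q (base u)) →
    StarForest E⁺ (Base P ∪ Q)
  Base-∪-StarForest {P} {Q} sfP sfQ ¬Q = StarForest-∪ (Base-StarForest sfP) sfQ Base∤Q Q∤Base
    where
    Base∤Q : Separated {E = E⁺} (Base P) Q
    Base∤Q {w = base _}   _        q _ = ¬Q q
    Base∤Q {w = copy _ _} (base _) _ ()
    Base∤Q {w = new _ _}  (base _) _ ()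

    Q∤Base : Separated {E = E⁺} Q (Base P)
    Q∤Base {u = base _}   q _        _ = ¬Q q
    Q∤Base {u = copy _ _} _ (base _) ()
    Q∤Base {u = new _ _}  _ (base _) ()

-- The construction of the tree-decompositions

record StarDecomposition (n : ℕ) : Set₁ where
  field
    decomposition : RootedDecomposition (GV n) (Adj n)
  open RootedDecomposition decomposition
  field
    star-forest-bags : ∀ t → StarForest (Adj n) (bag t)
    holder           : Ix n → Node
    holder-bag       : ∀ S {v} → Mem n S v → bag (holder S) v

finite-Ix : ∀ k → Finite (Ix (suc k))
finite-Ix zero    = finite-⊤
finite-Ix (suc k) = finite-× (finite-Ix k) (finite-× (finite-Ix k) finite-Bool)

star-decomposition₁ : StarDecomposition 1
star-decomposition₁ = record
  { decomposition = record
    { Node       = ⊤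
    ; finite     = finite-⊤
    ; tree       = record
      { Parent          = λ _ _ → ⊥
      ; forest          = record { parent-unique = λ () ; rank = λ _ → 0 ; rank-decreasing = λ () }
      ; root            = tt
      ; root-parentless = λ ()
      ; to-root         = λ _ → here tt
      }
    ; bag        = λ _ _ → ⊤
    ; edge-cover = λ _ _ ()
    ; home       = λ _ → tt
    ; home-bag   = λ _ → tt
    ; to-home    = λ _ _ → here tt
    }
  ; star-forest-bags = λ _ → Stable⇒StarForest λ _ _ ()
  ; holder           = λ _ → tt
  ; holder-bag       = λ _ _ → tt
  }

module Successor {k : ℕ} (D : StarDecomposition (suc k)) where
  open StarDecomposition D
  open RootedDecomposition decomposition
  open Graft tree holder

  private
    I : Set
    I = Ix (suc k)

    V⁺ : Set
    V⁺ = GV (suc (suc k))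

    E⁺ : V⁺ → V⁺ → Set
    E⁺ = Adj (suc (suc k))

    Node⁺ : Set
    Node⁺ = GraftNode Node I

    bag⁺ : Node⁺ → V⁺ → Set
    bag⁺ (old t)      = Base (bag t)
    bag⁺ (copied S t) = Base (Mem (suc k) S) ∪ Copy S (bag t)
    bag⁺ (leaf S Q)   = Base (Mem (suc k) S) ∪ (Copy S (Mem (suc k) Q) ∪ ｛ new S Q ｝)

    star-forest-bags⁺ : ∀ t → StarForest E⁺ (bag⁺ t)
    star-forest-bags⁺ (old t)      = Base-StarForest (star-forest-bags t)
    star-forest-bags⁺ (copied S t) =
      Base-∪-StarForest (Stable⇒StarForest (Mem-stable (suc k) S)) (Copy-StarForest (star-forest-bags t)) λ ()
    star-forest-bags⁺ (leaf S Q)   =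
      Base-∪-StarForest (Stable⇒StarForest (Mem-stable (suc k) S))
        (star-StarForest (Copy-stable (Mem-stable (suc k) Q)) λ { (copy m) → refl , m })
        λ { (inj₁ ()) ; (inj₂ ()) }

    edge-cover⁺ : ∀ u v → E⁺ u v → ∃[ t ] (bag⁺ t u × bag⁺ t v)
    edge-cover⁺ (base u)   (base w)   e with edge-cover u w e
    ... | t , bu , bw = old t , base bu , base bw
    edge-cover⁺ (copy S u) (copy _ w) (refl , e) with edge-cover u w e
    ... | t , bu , bw = copied S t , inj₂ (copy bu) , inj₂ (copy bw)
    edge-cover⁺ (copy S u) (new _ Q)  (refl , m) = leaf S Q , inj₂ (inj₁ (copy m)) , inj₂ (inj₂ refl)
    edge-cover⁺ (new S Q)  (copy _ u) (refl , m) = leaf S Q , inj₂ (inj₂ refl) , inj₂ (inj₁ (copy m))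
    edge-cover⁺ (base _)   (copy _ _) ()
    edge-cover⁺ (base _)   (new _ _)  ()
    edge-cover⁺ (copy _ _) (base _)   ()
    edge-cover⁺ (new _ _)  (base _)   ()
    edge-cover⁺ (new _ _)  (new _ _)  ()

    home⁺ : V⁺ → Node⁺
    home⁺ (base u)   = old (home u)
    home⁺ (copy S u) = copied S (home u)
    home⁺ (new S Q)  = leaf S Q

    home-bag⁺ : ∀ v → bag⁺ (home⁺ v) v
    home-bag⁺ (base u)   = base (home-bag u)
    home-bag⁺ (copy S u) = inj₂ (copy (home-bag u))
    home-bag⁺ (new S Q)  = inj₂ (inj₂ refl)

    base-to-home : ∀ S {u} → Mem (suc k) S u →
      ∀ a → Conn Edge⁺ (λ s → bag⁺ s (base u)) (copied S a) (home⁺ (base u))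
    base-to-home S m a =
      conn-++ (copied-to-holder S (λ _ → inj₁ (base m)) (base (holder-bag S m)) a)
              (old-walk base (to-home (holder S) (holder-bag S m)))

    to-home⁺ : ∀ {v} t → bag⁺ t v → Conn Edge⁺ (λ s → bag⁺ s v) t (home⁺ v)
    to-home⁺ (old a)      (base b)               = old-walk base (to-home a b)
    to-home⁺ (copied S a) (inj₁ (base m))        = base-to-home S m a
    to-home⁺ (copied S a) (inj₂ (copy b))        = copied-walk S (λ b → inj₂ (copy b)) (to-home a b)
    to-home⁺ (leaf S Q)   (inj₁ (base m))        =
      step (inj₁ (base m)) (fwd leaf-parent) (base-to-home S m (holder Q))
    to-home⁺ (leaf S Q)   (inj₂ (inj₁ (copy m))) =
      step (inj₂ (inj₁ (copy m))) (fwd leaf-parent)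
           (copied-walk S (λ b → inj₂ (copy b)) (to-home (holder Q) (holder-bag Q m)))
    to-home⁺ (leaf S Q)   (inj₂ (inj₂ refl))     = here (inj₂ (inj₂ refl))

    holder⁺ : Ix (suc (suc k)) → Node⁺
    holder⁺ (S , Q , _) = leaf S Q

    holder-bag⁺ : ∀ S {v} → Mem (suc (suc k)) S v → bag⁺ (holder⁺ S) v
    holder-bag⁺ (S , Q , true)  {base _}   m            = inj₁ (base m)
    holder-bag⁺ (S , Q , true)  {copy _ _} (refl , m)   = inj₂ (inj₁ (copy m))
    holder-bag⁺ (S , Q , true)  {new _ _}  ()
    holder-bag⁺ (S , Q , false) {base _}   m            = inj₁ (base m)
    holder-bag⁺ (S , Q , false) {copy _ _} ()
    holder-bag⁺ (S , Q , false) {new _ _}  (refl , refl) = inj₂ (inj₂ refl)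

  star-decomposition⁺ : StarDecomposition (suc (suc k))
  star-decomposition⁺ = record
    { decomposition = record
      { Node       = Node⁺
      ; finite     = finite-⊎ finite
                       (finite-⊎ (finite-× (finite-Ix k) finite) (finite-× (finite-Ix k) (finite-Ix k)))
      ; tree       = grafted
      ; bag        = bag⁺
      ; edge-cover = edge-cover⁺
      ; home       = home⁺
      ; home-bag   = home-bag⁺
      ; to-home    = to-home⁺
      }
    ; star-forest-bags = star-forest-bags⁺
    ; holder           = holder⁺
    ; holder-bag       = holder-bag⁺
    }

star-decomposition : ∀ k → StarDecomposition (suc k)
star-decomposition zero    = star-decomposition₁
star-decomposition (suc k) = Successor.star-decomposition⁺ (star-decomposition k)

lemma3p1 : (n : ℕ) → 1 ≤ n →
    Σ (TreeDecomposition (GV n) (Adj n)) λ 𝒯 →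
      (∀ t → StarForest (Adj n) (TreeDecomposition.bag 𝒯 t)) ×
      (∀ (S : Ix n) → ∃[ t ] (∀ v → Mem n S v → TreeDecomposition.bag 𝒯 t v))
lemma3p1 zero    ()
lemma3p1 (suc k) _ =
  toTreeDecomposition decomposition ,
  (λ i → star-forest-bags _) ,
  λ S → _ , λ v m → bag-to decomposition (holder-bag S m)
  where open StarDecomposition (star-decomposition k)
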